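{- Every pseudo-outerplanar graph has arboricity at most $3$. Moreover, there exists a pseudo-outerplanar graph with arboricity exactly $3$.
   Context: All graphs are finite, simple and undirected. A block is a maximal 2-connected subgraph; bridges are blocks too. A graph is pseudo-outerplanar if each of its blocks can be drawn in the plane so that its vertices lie on a fixed circle, its edges lie inside the disk bounded by that circle, and each edge crosses at most one other edge. The arboricity of a graph is the minimum number of forests into which its edge set can be partitioned. -}

module Defs where

open import Data.Nat using (ℕ; zero; suc)
open import Data.Fin using (Fin; zero; suc; inject₁; fromℕ; _<_)
open import Data.Bool using (Bool; true; false; _∧_; not)
open import Data.Fin using (_≟_)
open import Relation.Nullary.Decidable using (⌊_⌋)
open import Data.Product using (Σ; ∃; _×_; _,_)
open import Data.Sum using (_⊎_)
open import Relation.Nullary using (¬_)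
open import Relation.Binary.PropositionalEquality using (_≡_)
open import Function.Definitions using (Injective)

record Graph : Set where
  field
    n       : ℕ
    adj     : Fin n → Fin n → Bool
    adj-sym : ∀ u v → adj u v ≡ adj v u
    adj-irr : ∀ u → adj u u ≡ false
open Graph public

VSet : ℕ → Set
VSet n = Fin n → Bool

_⊆_ : ∀ {n} → VSet n → VSet n → Set
A ⊆ B = ∀ x → A x ≡ true → B x ≡ true

_─_ : ∀ {n} → VSet n → Fin n → VSet n
(S ─ x) y = S y ∧ not ⌊ y ≟ x ⌋

module _ (G : Graph) where

  -- Reach S u v : there is a walk from u to v whose vertices after u lie in S.
  data Reach (S : VSet (n G)) : Fin (n G) → Fin (n G) → Set where
    here : ∀ {u} → Reach S u u
    step : ∀ {u v w} → adj G u v ≡ true → S v ≡ true → Reach S v w → Reach S u w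

  Connected : VSet (n G) → Set
  Connected S = ∀ u v → S u ≡ true → S v ≡ true → Reach S u v

  -- G[S] is nonempty, connected, and has no cut vertex
  -- (K1, K2 and 2-connected graphs).
  Nonseparable : VSet (n G) → Set
  Nonseparable S =
    (∃ λ x → S x ≡ true) × Connected S × (∀ x → S x ≡ true → Connected (S ─ x))

  IsBlock : VSet (n G) → Set
  IsBlock B = Nonseparable B × (∀ B' → B ⊆ B' → Nonseparable B' → B' ⊆ B)

  -- Circular drawing of G[B]: the vertices of B are placed on a circle in the
  -- cyclic order f 0, f 1, ..., f (k-1); edges are drawn as chords.
  Chord : ∀ {k} → (Fin k → Fin (n G)) → Fin k → Fin k → Set
  Chord f a b = (a < b) × (adj G (f a) (f b) ≡ true)

  -- Chords (a,b) and (c,d) (a<b, c<d) cross iff their endpoints interleave.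
  Cross : ∀ {k} → Fin k → Fin k → Fin k → Fin k → Set
  Cross a b c d = (a < c × c < b × b < d) ⊎ (c < a × a < d × d < b)

  PODrawing : VSet (n G) → Set
  PODrawing B =
    Σ ℕ λ k → Σ (Fin k → Fin (n G)) λ f →
      Injective _≡_ _≡_ f ×
      (∀ i → B (f i) ≡ true) ×
      (∀ x → B x ≡ true → ∃ λ i → f i ≡ x) ×
      -- every edge crosses at most one other edge
      (∀ a b c d c' d' → Chord f a b → Chord f c d → Chord f c' d' →
         Cross a b c d → Cross a b c' d' → (c ≡ c') × (d ≡ d'))

  PseudoOuterplanar : Set
  PseudoOuterplanar = ∀ B → IsBlock B → PODrawing B

  MonoCycle : ∀ {k} → (Fin (n G) → Fin (n G) → Fin k) → Fin k → Set
  MonoCycle col i =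
    Σ ℕ λ m → Σ (Fin (suc (suc (suc m))) → Fin (n G)) λ g →
      Injective _≡_ _≡_ g ×
      (∀ j → adj G (g (inject₁ j)) (g (suc j)) ≡ true × col (g (inject₁ j)) (g (suc j)) ≡ i) ×
      (adj G (g (fromℕ (suc (suc m)))) (g zero) ≡ true × col (g (fromℕ (suc (suc m)))) (g zero) ≡ i)

  -- The edge set can be partitioned into k forests: a (symmetric) edge
  -- colouring with k colours such that no colour class contains a cycle.
  ForestPartition : ℕ → Set
  ForestPartition k =
    Σ (Fin (n G) → Fin (n G) → Fin k) λ col →
      (∀ u v → col u v ≡ col v u) × (∀ i → ¬ MonoCycle col i)

  ArboricityAtMost : ℕ → Set
  ArboricityAtMost k = ForestPartition k

  ArboricityExactly : ℕ → Set
  ArboricityExactly zero = ForestPartition zero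
  ArboricityExactly (suc k) = ForestPartition (suc k) × ¬ ForestPartition k

-- Fix a circular drawing of a block in which every edge crosses at most one other edge, and
-- orient each edge xy so that x comes before y. Colour it 0 if no edge into y starts before x,
-- 1 if some does but no edge out of x ends after y, and 2 otherwise. In a cycle of colour 0
-- or 2 consider its last vertex y, whose cycle neighbours x₁ < x₂ both come before y: colour 0
-- is impossible because x₁y enters y before x₂, and colour 2 because an edge entering y
-- before x₁ crosses both an edge leaving x₁ and an edge leaving x₂ beyond y. Colour 1 is
-- excluded in the same way at the first vertex of the cycle. A cycle lies inside one block,
-- so colouring every edge through the drawing of its block splits a pseudo-outerplanar graph
-- into three forests. Two copies of K₄ glued along an edge are pseudo-outerplanar, and their
-- 11 > 2·5 edges do not split into two forests; this is checked exhaustively.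
module Submission where

open import Data.Bool using (Bool; true; false; _∧_; _∨_; not)
open import Data.Bool.Properties using (∨-zeroʳ) renaming (_≟_ to _≟ᵇ_)
open import Data.Empty using (⊥; ⊥-elim)
open import Data.Fin as Fin using (Fin; zero; suc; toℕ; fromℕ; fromℕ<; inject₁; #_)
open import Data.Fin.Properties
  using (_≟_; any?; all?; ¬∀⟶∃¬; toℕ-fromℕ<; toℕ-injective; toℕ-inject₁; toℕ-fromℕ; toℕ<n)
open import Data.Fin.Subset using (Subset; _⊂_; _⊃_)
open import Data.Fin.Subset.Properties using (anySubset?)
open import Data.Fin.Subset.Induction using (⊂-wellFounded; ⊃-wellFounded)
open import Data.List using (List; []; _∷_; allFin)
open import Data.List.Extrema.Nat using (argmax; argmin; f[xs]≤f[argmax]; f[argmin]≤f[xs])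
open import Data.List.Membership.Propositional.Properties using (∈-allFin)
open import Data.List.Relation.Unary.All as All using (All; lookupAny)
open import Data.List.Relation.Unary.Any as Any using (Any)
open import Data.Nat using (ℕ; zero; suc; z≤n; s≤s; _+_; _*_; _∸_; _<_; _≤_; _<?_; NonZero)
open import Data.Nat.DivMod
  using (_%_; _/_; _mod_; m≡m%n+[m/n]*n; [m+kn]%n≡m%n; [m+n]%n≡m%n; m<n⇒m%n≡m; m%n<n; n%n≡0; m≤n⇒[n∸m]%m≡n%m)
open import Data.Nat.Properties
  using ( +-comm; +-assoc; +-identityʳ; +-suc; +-cancelˡ-≡; +-cancelʳ-<; +-mono-<; +-monoˡ-≤; +-monoʳ-<
        ; ≤-refl; ≤-reflexive; ≤-trans; ≤-antisym; ≤-pred; ≤-<-trans; <-≤-trans; <-trans; <-cmp; <⇒≢; ≤∧≢⇒<; ≮⇒≥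
        ; m≤m+n; m≤n⇒m≤1+n; m∸n+n≡m; m+n∸n≡m; ∸-monoˡ-<)
open import Data.Product using (Σ; ∃; _×_; _,_; proj₁; proj₂)
open import Data.Product.Properties using (≡-dec)
open import Data.Sum using (_⊎_; inj₁; inj₂; [_,_])
open import Data.Vec using (Vec; []; _∷_; lookup; tabulate)
open import Data.Vec.Properties using (lookup∘tabulate; tabulate-cong; []=⇒lookup; lookup⇒[]=)
open import Function using (_∘_; id)
open import Function.Definitions using (Injective)
open import Induction.WellFounded using (Acc; acc)
open import Relation.Binary using (tri<; tri≈; tri>)
open import Relation.Binary.PropositionalEquality
  using (_≡_; _≢_; _≗_; refl; sym; trans; cong; subst; subst₂; module ≡-Reasoning)
open import Relation.Nullary using (¬_; Dec; yes; no)
open import Relation.Nullary.Decidable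
  using (⌊_⌋; _×-dec_; _⊎-dec_; _→-dec_; ¬?; map′; decidable-stable; from-yes; from-no)

open import Defs

-- Vertex sets

⌊⌋-intro : ∀ {A : Set} (a? : Dec A) → A → ⌊ a? ⌋ ≡ true
⌊⌋-intro (yes _) _ = refl
⌊⌋-intro (no ¬a) a = ⊥-elim (¬a a)

⌊⌋-elim : ∀ {A : Set} (a? : Dec A) → ⌊ a? ⌋ ≡ true → A
⌊⌋-elim (yes a) _ = a

module _ {m : ℕ} where

  ⊆-refl : {S : VSet m} → S ⊆ S
  ⊆-refl _ Sx = Sx

  ⊆-trans : {R S T : VSet m} → R ⊆ S → S ⊆ T → R ⊆ T
  ⊆-trans R⊆S S⊆T x Rx = S⊆T x (R⊆S x Rx)

  ⊆-antisym : {S T : VSet m} → S ⊆ T → T ⊆ S → S ≗ T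
  ⊆-antisym {S} {T} S⊆T T⊆S x with S x in Sx | T x in Tx
  ... | true  | true  = refl
  ... | false | false = refl
  ... | true  | false = trans (sym (S⊆T x Sx)) Tx
  ... | false | true  = trans (sym Sx) (T⊆S x Tx)

  ≗⇒⊆ : {S T : VSet m} → S ≗ T → S ⊆ T
  ≗⇒⊆ S≗T x Sx = trans (sym (S≗T x)) Sx

  ⊆? : (S T : VSet m) → Dec (S ⊆ T)
  ⊆? S T = all? λ x → (S x ≟ᵇ true) →-dec (T x ≟ᵇ true)

  ⊈⇒∃ : {S T : VSet m} → ¬ (S ⊆ T) → ∃ λ x → S x ≡ true × T x ≢ true
  ⊈⇒∃ {S} {T} S⊈T with ¬∀⟶∃¬ m _ (λ x → (S x ≟ᵇ true) →-dec (T x ≟ᵇ true)) S⊈T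
  ... | x , ¬Sx⇒Tx with S x ≟ᵇ true
  ...   | yes Sx = x , Sx , λ Tx → ¬Sx⇒Tx λ _ → Tx
  ...   | no ¬Sx = ⊥-elim (¬Sx⇒Tx λ Sx → ⊥-elim (¬Sx Sx))

  ─-intro : {S : VSet m} {x y : Fin m} → S y ≡ true → y ≢ x → (S ─ x) y ≡ true
  ─-intro {x = x} {y} Sy y≢x with y ≟ x
  ... | yes y≡x = ⊥-elim (y≢x y≡x)
  ... | no _ rewrite Sy = refl

  ─-elim : {S : VSet m} {x y : Fin m} → (S ─ x) y ≡ true → S y ≡ true × y ≢ x
  ─-elim {S} {x} {y} _ with S y | y ≟ x
  ... | true | no y≢x = refl , y≢x

  ─-⊆ : {S : VSet m} {x : Fin m} → (S ─ x) ⊆ S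
  ─-⊆ {S} {x} _ = proj₁ ∘ ─-elim {S = S} {x}

  ─-mono : {S T : VSet m} {x : Fin m} → S ⊆ T → (S ─ x) ⊆ (T ─ x)
  ─-mono {S} {T} {x} S⊆T y S─y = let Sy , y≢x = ─-elim {S = S} {x} S─y in ─-intro {S = T} (S⊆T y Sy) y≢x

  ─-≗ : {S T : VSet m} {x : Fin m} → S ≗ T → (S ─ x) ≗ (T ─ x)
  ─-≗ {x = x} S≗T y = cong (λ b → b ∧ not ⌊ y ≟ x ⌋) (S≗T y)

  _∪_ : VSet m → VSet m → VSet m
  (S ∪ T) x = S x ∨ T x

  ∪-⊆ˡ : {S T : VSet m} → S ⊆ (S ∪ T)
  ∪-⊆ˡ x Sx rewrite Sx = refl

  ∪-⊆ʳ : {S T : VSet m} → T ⊆ (S ∪ T)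
  ∪-⊆ʳ {S} x Tx = trans (cong (S x ∨_) Tx) (∨-zeroʳ (S x))

  ∪-elim : {S T : VSet m} {x : Fin m} → (S ∪ T) x ≡ true → S x ≡ true ⊎ T x ≡ true
  ∪-elim {S} {x = x} STx with S x
  ... | true  = inj₁ refl
  ... | false = inj₂ STx

  ∪-─-elim : {S T : VSet m} {x y : Fin m} → ((S ∪ T) ─ x) y ≡ true → (S ─ x) y ≡ true ⊎ (T ─ x) y ≡ true
  ∪-─-elim {S} {T} {x} ST─y with ─-elim {S = S ∪ T} {x} ST─y
  ... | STy , y≢x with ∪-elim {S = S} {T} STy
  ...   | inj₁ Sy = inj₁ (─-intro {S = S} Sy y≢x)
  ...   | inj₂ Ty = inj₂ (─-intro {S = T} Ty y≢x)

  lookup-⊂ : {p q : Subset m} {x : Fin m} → lookup p ⊆ lookup q → lookup q x ≡ true → lookup p x ≢ true → p ⊂ q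
  lookup-⊂ {p} {q} {x} p⊆q qx ¬px =
    (λ {y} y∈p → lookup⇒[]= y q (p⊆q y ([]=⇒lookup y∈p))) , x , lookup⇒[]= x q qx , ¬px ∘ []=⇒lookup

  Extensional : (VSet m → Set) → Set
  Extensional P = ∀ {S T} → S ≗ T → P S → P T

  ∀⊎∃¬ : (P : VSet m → Set) → Extensional P → (∀ S → Dec (P S)) → (∀ S → P S) ⊎ ∃ λ S → ¬ P S
  ∀⊎∃¬ P ext P? with anySubset? (λ p → ¬? (P? (lookup p)))
  ... | yes (p , ¬Pp) = inj₂ (lookup p , ¬Pp)
  ... | no ∄ = inj₁ λ S → decidable-stable (P? S) λ ¬PS → ∄ (tabulate S , ¬PS ∘ ext (lookup∘tabulate S))

-- Cyclic indexing

module _ {d : ℕ} .{{_ : NonZero d}} where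

  [m+n]%d≡[m%d+n]%d : ∀ m n → (m + n) % d ≡ (m % d + n) % d
  [m+n]%d≡[m%d+n]%d m n = begin
    (m + n) % d                   ≡⟨ cong (λ x → (x + n) % d) (m≡m%n+[m/n]*n m d) ⟩
    (m % d + m / d * d + n) % d   ≡⟨ cong (_% d) (+-assoc (m % d) _ n) ⟩
    (m % d + (m / d * d + n)) % d ≡⟨ cong (λ x → (m % d + x) % d) (+-comm (m / d * d) n) ⟩
    (m % d + (n + m / d * d)) % d ≡⟨ cong (_% d) (sym (+-assoc (m % d) n _)) ⟩
    (m % d + n + m / d * d) % d   ≡⟨ [m+kn]%n≡m%n (m % d + n) (m / d) d ⟩
    (m % d + n) % d               ∎
    where open ≡-Reasoning

  [t+m]%d≢m%d : ∀ m t → 0 < t → t < d → (t + m) % d ≢ m % d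
  [t+m]%d≢m%d m t 0<t t<d eq = by-cases (r + t <? d)
    where
      open ≡-Reasoning
      r = m % d
      [r+t]%d≡r : (r + t) % d ≡ r
      [r+t]%d≡r = trans (sym ([m+n]%d≡[m%d+n]%d m t)) (trans (cong (_% d) (+-comm m t)) eq)

      by-cases : Dec (r + t < d) → ⊥
      by-cases (yes r+t<d) = <⇒≢ 0<t (sym (+-cancelˡ-≡ r t 0 (begin
        r + t             ≡⟨ sym (m<n⇒m%n≡m r+t<d) ⟩
        (r + t) % d       ≡⟨ [r+t]%d≡r ⟩
        r                 ≡⟨ sym (+-identityʳ r) ⟩
        r + 0             ∎)))
      by-cases (no r+t≮d) = <⇒≢ t<d (+-cancelˡ-≡ r t d (begin
        r + t             ≡⟨ sym (m∸n+n≡m d≤r+t) ⟩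
        r + t ∸ d + d     ≡⟨ cong (_+ d) (trans (sym (m<n⇒m%n≡m r+t∸d<d)) (trans (m≤n⇒[n∸m]%m≡n%m d≤r+t) [r+t]%d≡r)) ⟩
        r + d             ∎))
        where
          d≤r+t = ≮⇒≥ r+t≮d
          r+t∸d<d : r + t ∸ d < d
          r+t∸d<d = subst (r + t ∸ d <_) (m+n∸n≡m d d) (∸-monoˡ-< (+-mono-< (m%n<n m d) t<d) d≤r+t)

module CyclicIndex {A : Set} (m : ℕ) (g : Fin (suc (suc (suc m))) → A) where

  K : ℕ
  K = suc (suc (suc m))

  at : ℕ → A
  at s = g (s mod K)

  at≡g : ∀ s j → s % K ≡ toℕ j → at s ≡ g j
  at≡g s j eq = cong g (toℕ-injective (trans (toℕ-fromℕ< _) eq))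

  at-toℕ : ∀ j → at (toℕ j) ≡ g j
  at-toℕ j = at≡g (toℕ j) j (m<n⇒m%n≡m (toℕ<n j))

  at-periodic : ∀ s → at (K + s) ≡ at s
  at-periodic s = at≡g (K + s) (s mod K) (trans (cong (_% K) (+-comm K s)) (trans ([m+n]%n≡m%n s K) (sym (toℕ-fromℕ< _))))

  at-step : (R : A → A → Set) → (∀ j → R (g (inject₁ j)) (g (suc j))) → R (g (fromℕ (suc (suc m)))) (g zero) →
            ∀ s → R (at s) (at (suc s))
  at-step R path close s = by-cases (suc r <? K)
    where
      r = s % K
      [1+s]%K : suc s % K ≡ suc r % K
      [1+s]%K = trans (cong (_% K) (+-comm 1 s)) (trans ([m+n]%d≡[m%d+n]%d s 1) (cong (_% K) (+-comm r 1)))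

      by-cases : Dec (suc r < K) → R (at s) (at (suc s))
      by-cases (yes r+1<K) = subst₂ R (sym (at≡g s (inject₁ j) (sym (trans (toℕ-inject₁ j) (toℕ-fromℕ< _)))))
                                      (sym (at≡g (suc s) (suc j) (trans [1+s]%K (trans (m<n⇒m%n≡m r+1<K) (sym (cong suc (toℕ-fromℕ< _)))))))
                                      (path j)
        where j = fromℕ< (≤-pred r+1<K)
      by-cases (no r+1≮K) = subst₂ R (sym (at≡g s (fromℕ (suc (suc m))) (trans r≡K-1 (sym (toℕ-fromℕ _)))))
                                     (sym (at≡g (suc s) zero (trans [1+s]%K (trans (cong (λ i → suc i % K) r≡K-1) (n%n≡0 K)))))
                                     close
        where r≡K-1 = ≤-antisym (≤-pred (m%n<n s K)) (≤-pred (≮⇒≥ r+1≮K))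

  module _ (g-injective : Injective _≡_ _≡_ g) where

    at-window : ∀ s t → 0 < t → t < K → at (t + s) ≢ at s
    at-window s t 0<t t<K eq =
      [t+m]%d≢m%d s t 0<t t<K (trans (sym (toℕ-fromℕ< _)) (trans (cong toℕ (g-injective eq)) (toℕ-fromℕ< _)))

    module _ (ρ : A → ℕ) (ρ-injective : ∀ s t → ρ (at s) ≡ ρ (at t) → at s ≡ at t) where

      private
        ρ-step-≢ : ∀ s → ρ (at (suc s)) ≢ ρ (at s)
        ρ-step-≢ s eq = at-window s 1 (s≤s z≤n) (s≤s (s≤s z≤n)) (ρ-injective (suc s) s eq)

        after-lap : ∀ j → at (suc (suc (suc m) + toℕ j)) ≡ g j
        after-lap j = trans (at-periodic (toℕ j)) (at-toℕ j)

      peak : ∃ λ s → ρ (at s) < ρ (at (1 + s)) × ρ (at (2 + s)) < ρ (at (1 + s))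
      peak = s , ≤∧≢⇒< (below s) (ρ-step-≢ s ∘ sym) , ≤∧≢⇒< (below (2 + s)) (ρ-step-≢ (1 + s))
        where
          j = argmax (ρ ∘ g) zero (allFin K)
          s = suc (suc m) + toℕ j
          below : ∀ t → ρ (at t) ≤ ρ (at (1 + s))
          below t = subst (ρ (at t) ≤_) (cong ρ (sym (after-lap j)))
                          (All.lookup (f[xs]≤f[argmax] {f = ρ ∘ g} zero (allFin K)) (∈-allFin (t mod K)))

      valley : ∃ λ s → ρ (at (1 + s)) < ρ (at s) × ρ (at (1 + s)) < ρ (at (2 + s))
      valley = s , ≤∧≢⇒< (above s) (ρ-step-≢ s) , ≤∧≢⇒< (above (2 + s)) (ρ-step-≢ (1 + s) ∘ sym)
        where
          j = argmin (ρ ∘ g) zero (allFin K)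
          s = suc (suc m) + toℕ j
          above : ∀ t → ρ (at (1 + s)) ≤ ρ (at t)
          above t = subst (_≤ ρ (at t)) (cong ρ (sym (after-lap j)))
                          (All.lookup (f[argmin]≤f[xs] {f = ρ ∘ g} zero (allFin K)) (∈-allFin (t mod K)))

module _ (G : Graph) where

  private
    N = n G
    V = Fin N

  -- Walks

  infix 4 _~_ _~?_
  _~_ : V → V → Set
  u ~ v = adj G u v ≡ true

  _~?_ : ∀ u v → Dec (u ~ v)
  u ~? v = adj G u v ≟ᵇ true

  ~-sym : ∀ {u v} → u ~ v → v ~ u
  ~-sym {u} {v} u~v = trans (adj-sym G v u) u~v

  ~-irrefl : ∀ {u v} → u ~ v → u ≢ v
  ~-irrefl {u} u~u refl with trans (sym u~u) (adj-irr G u)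
  ... | ()

  module _ {S : VSet N} where

    reach-trans : ∀ {u v w} → Reach G S u v → Reach G S v w → Reach G S u w
    reach-trans here            r′ = r′
    reach-trans (step u~w Sw r) r′ = step u~w Sw (reach-trans r r′)

    reach-snoc : ∀ {u v w} → Reach G S u v → v ~ w → S w ≡ true → Reach G S u w
    reach-snoc r v~w Sw = reach-trans r (step v~w Sw here)

    reach-sym : ∀ {u v} → S u ≡ true → Reach G S u v → Reach G S v u
    reach-sym Su here            = here
    reach-sym Su (step u~w Sw r) = reach-snoc (reach-sym Sw r) (~-sym u~w) Su

  reach-mono : ∀ {S T u v} → S ⊆ T → Reach G S u v → Reach G T u v
  reach-mono S⊆T here            = here
  reach-mono S⊆T (step u~w Sw r) = step u~w (S⊆T _ Sw) (reach-mono S⊆T r)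

  reach-last-visit : ∀ {S u v} z → Reach G S u v → Reach G (S ─ z) u v ⊎ Reach G (S ─ z) z v
  reach-last-visit z here = inj₁ here
  reach-last-visit {S} z (step {v = w} u~w Sw r) with reach-last-visit z r
  ... | inj₂ r′ = inj₂ r′
  ... | inj₁ r′ with w ≟ z
  ...   | yes refl = inj₂ r′
  ...   | no w≢z   = inj₁ (step u~w (─-intro {S = S} Sw w≢z) r′)

  reach-first-step : ∀ {S u v} → Reach G S u v → u ≡ v ⊎ ∃ λ w → u ~ w × S w ≡ true × Reach G (S ─ w) w v
  reach-first-step here                    = inj₁ refl
  reach-first-step (step {v = w} u~w Sw r) = inj₂ (w , u~w , Sw , [ id , id ] (reach-last-visit w r))

  -- Recursion on the set of allowed vertices, which shrinks because a walk need never return to its second vertex.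
  reach-subset? : ∀ p → Acc _⊂_ p → ∀ u v → Dec (Reach G (lookup p) u v)
  reach-subset? p (acc rs) u v with u ≟ v
  ... | yes refl = yes here
  ... | no u≢v   = map′ (λ (w , u~w , pw , r) → step u~w pw (reach-mono (─-⊆ {S = lookup p}) r))
                        ([ ⊥-elim ∘ u≢v , id ] ∘ reach-first-step)
                        (any? first-step?)
    where
      first-step? : ∀ w → Dec (u ~ w × lookup p w ≡ true × Reach G (lookup p ─ w) w v)
      first-step? w with u ~? w | lookup p w ≟ᵇ true
      ... | no ¬u~w | _      = no (¬u~w ∘ proj₁)
      ... | yes _   | no ¬pw = no (¬pw ∘ proj₁ ∘ proj₂)
      ... | yes u~w | yes pw = map′ (λ r → u~w , pw , reach-mono (≗⇒⊆ (lookup∘tabulate _)) r)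
                                    (λ (_ , _ , r) → reach-mono (≗⇒⊆ (sym ∘ lookup∘tabulate _)) r)
                                    (reach-subset? q (rs q⊂p) w v)
        where
          q = tabulate (lookup p ─ w)
          q⊂p : q ⊂ p
          q⊂p = lookup-⊂ (⊆-trans (≗⇒⊆ (lookup∘tabulate _)) (─-⊆ {S = lookup p})) pw
                  (λ qw → proj₂ (─-elim {S = lookup p} (trans (sym (lookup∘tabulate _ w)) qw)) refl)

  reach? : ∀ S u v → Dec (Reach G S u v)
  reach? S u v = map′ (reach-mono (≗⇒⊆ (lookup∘tabulate S))) (reach-mono (≗⇒⊆ (sym ∘ lookup∘tabulate S)))
                      (reach-subset? (tabulate S) (⊂-wellFounded _) u v)

  -- Nonseparable sets and blocks

  connected? : ∀ S → Dec (Connected G S)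
  connected? S = all? λ u → all? λ v → (S u ≟ᵇ true) →-dec ((S v ≟ᵇ true) →-dec reach? S u v)

  nonseparable? : ∀ S → Dec (Nonseparable G S)
  nonseparable? S = any? (λ x → S x ≟ᵇ true) ×-dec connected? S ×-dec all? (λ x → (S x ≟ᵇ true) →-dec connected? (S ─ x))

  connected-≗ : Extensional (Connected G)
  connected-≗ S≗T conn u v Tu Tv = reach-mono (≗⇒⊆ S≗T) (conn u v (trans (S≗T u) Tu) (trans (S≗T v) Tv))

  nonseparable-≗ : Extensional (Nonseparable G)
  nonseparable-≗ S≗T ((x , Sx) , conn , conn─) =
    (x , trans (sym (S≗T x)) Sx) , connected-≗ S≗T conn , λ y Ty → connected-≗ (─-≗ S≗T) (conn─ y (trans (S≗T y) Ty))

  connected-from : ∀ {S} c → S c ≡ true → (∀ u → S u ≡ true → Reach G S c u) → Connected G S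
  connected-from c Sc from-c u v Su Sv = reach-trans (reach-sym Sc (from-c u Su)) (from-c v Sv)

  nonseparable⇒connected-─ : ∀ {S} → Nonseparable G S → ∀ z → Connected G (S ─ z)
  nonseparable⇒connected-─ {S} (_ , conn , conn─) z with S z ≟ᵇ true
  ... | yes Sz = conn─ z Sz
  ... | no ¬Sz = λ u v S─u S─v → reach-mono (λ y Sy → ─-intro {S = S} Sy λ { refl → ¬Sz Sy })
                                   (conn u v (proj₁ (─-elim {S = S} S─u)) (proj₁ (─-elim {S = S} S─v)))

  nonseparable-∪ : ∀ {S T a b} → a ≢ b → S a ≡ true → S b ≡ true → T a ≡ true → T b ≡ true →
                   Nonseparable G S → Nonseparable G T → Nonseparable G (S ∪ T)
  nonseparable-∪ {S} {T} {a} {b} a≢b Sa Sb Ta Tb nsS nsT =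
    (a , S∪Ta) , connected-from a S∪Ta reach-from-a , λ z _ → connected─ z
    where
      S∪Ta = ∪-⊆ˡ {S = S} {T} a Sa

      reach-from-a : ∀ u → (S ∪ T) u ≡ true → Reach G (S ∪ T) a u
      reach-from-a u STu with ∪-elim {S = S} {T} STu
      ... | inj₁ Su = reach-mono (∪-⊆ˡ {S = S} {T}) (proj₁ (proj₂ nsS) a u Sa Su)
      ... | inj₂ Tu = reach-mono (∪-⊆ʳ {S = S} {T}) (proj₁ (proj₂ nsT) a u Ta Tu)

      shared-≢ : ∀ z → ∃ λ c → S c ≡ true × T c ≡ true × c ≢ z
      shared-≢ z with a ≟ z
      ... | no a≢z   = a , Sa , Ta , a≢z
      ... | yes refl = b , Sb , Tb , a≢b ∘ sym

      connected─ : ∀ z → Connected G ((S ∪ T) ─ z)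
      connected─ z with shared-≢ z
      ... | c , Sc , Tc , c≢z = connected-from c (─-intro {S = S ∪ T} (∪-⊆ˡ {S = S} {T} c Sc) c≢z) reach-from-c
        where
          reach-from-c : ∀ u → ((S ∪ T) ─ z) u ≡ true → Reach G ((S ∪ T) ─ z) c u
          reach-from-c u ST─u with ∪-─-elim {S = S} {T} {z} ST─u
          ... | inj₁ S─u = reach-mono (─-mono {S = S} (∪-⊆ˡ {S = S} {T}))
                                      (nonseparable⇒connected-─ nsS z c u (─-intro {S = S} Sc c≢z) S─u)
          ... | inj₂ T─u = reach-mono (─-mono {S = T} (∪-⊆ʳ {S = S} {T}))
                                      (nonseparable⇒connected-─ nsT z c u (─-intro {S = T} Tc c≢z) T─u)

  NoExtension : VSet N → VSet N → Set
  NoExtension B S = B ⊆ S → Nonseparable G S → S ⊆ B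

  no-extension? : ∀ B S → Dec (NoExtension B S)
  no-extension? B S = ⊆? B S →-dec (nonseparable? S →-dec ⊆? S B)

  no-extension-≗ : ∀ B → Extensional (NoExtension B)
  no-extension-≗ B S≗T no-ext B⊆T nsT = ⊆-trans T⊆S (no-ext (⊆-trans B⊆T T⊆S) (nonseparable-≗ (sym ∘ S≗T) nsT))
    where T⊆S = ≗⇒⊆ (sym ∘ S≗T)

  proper-extension : ∀ {B} S → ¬ NoExtension B S → B ⊆ S × Nonseparable G S × ∃ λ x → S x ≡ true × B x ≢ true
  proper-extension {B} S ¬no-ext with ⊆? B S | nonseparable? S | ⊆? S B
  ... | no B⊈S  | _       | _       = ⊥-elim (¬no-ext λ B⊆S → ⊥-elim (B⊈S B⊆S))
  ... | yes _   | no ¬nsS | _       = ⊥-elim (¬no-ext λ _ nsS → ⊥-elim (¬nsS nsS))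
  ... | yes _   | yes _   | yes S⊆B = ⊥-elim (¬no-ext λ _ _ → S⊆B)
  ... | yes B⊆S | yes nsS | no S⊈B  = B⊆S , nsS , ⊈⇒∃ S⊈B

  block? : ∀ B → Dec (IsBlock G B)
  block? B with nonseparable? B | ∀⊎∃¬ (NoExtension B) (no-extension-≗ B) (no-extension? B)
  ... | no ¬nsB | _               = no (¬nsB ∘ proj₁)
  ... | yes nsB | inj₁ maximal    = yes (nsB , maximal)
  ... | yes _   | inj₂ (S , ¬max) = no λ (_ , maximal) → ¬max (maximal S)

  block-⊇-subset : ∀ p → Acc _⊃_ p → Nonseparable G (lookup p) → ∃ λ B → IsBlock G B × lookup p ⊆ B
  block-⊇-subset p (acc rs) nsp with ∀⊎∃¬ (NoExtension (lookup p)) (no-extension-≗ _) (no-extension? _)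
  ... | inj₁ maximal = lookup p , (nsp , maximal) , ⊆-refl
  ... | inj₂ (S , ¬no-ext) with proper-extension S ¬no-ext
  ...   | p⊆S , nsS , x , Sx , ¬px =
    let B , isB , q⊆B = block-⊇-subset q (rs p⊂q) (nonseparable-≗ S≗q nsS)
    in  B , isB , ⊆-trans p⊆S (⊆-trans (≗⇒⊆ S≗q) q⊆B)
    where
      q = tabulate S
      S≗q = sym ∘ lookup∘tabulate S
      p⊂q : p ⊂ q
      p⊂q = lookup-⊂ (⊆-trans p⊆S (≗⇒⊆ S≗q)) (trans (lookup∘tabulate S x) Sx) ¬px

  block-⊇ : ∀ {S} → Nonseparable G S → ∃ λ B → IsBlock G B × S ⊆ B
  block-⊇ {S} nsS =
    let B , isB , q⊆B = block-⊇-subset (tabulate S) (⊃-wellFounded _) (nonseparable-≗ S≗q nsS)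
    in  B , isB , ⊆-trans (≗⇒⊆ S≗q) q⊆B
    where S≗q = sym ∘ lookup∘tabulate S

  nonseparable⊆block : ∀ {B S a b} → IsBlock G B → Nonseparable G S → a ≢ b →
                       B a ≡ true → B b ≡ true → S a ≡ true → S b ≡ true → S ⊆ B
  nonseparable⊆block {B} {S} (nsB , maximal) nsS a≢b Ba Bb Sa Sb =
    ⊆-trans (∪-⊆ʳ {S = B} {S}) (maximal (B ∪ S) (∪-⊆ˡ {S = B} {S}) (nonseparable-∪ a≢b Ba Bb Sa Sb nsB nsS))

  blocks-≗ : ∀ {B C a b} → IsBlock G B → IsBlock G C → a ≢ b →
             B a ≡ true → B b ≡ true → C a ≡ true → C b ≡ true → B ≗ C
  blocks-≗ isB isC a≢b Ba Bb Ca Cb =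
    ⊆-antisym (nonseparable⊆block isC (proj₁ isB) a≢b Ca Cb Ba Bb) (nonseparable⊆block isB (proj₁ isC) a≢b Ba Bb Ca Cb)

  block-≗ : Extensional (IsBlock G)
  block-≗ S≗T (nsS , maximal) =
    nonseparable-≗ S≗T nsS , λ U T⊆U nsU → ⊆-trans (maximal U (⊆-trans (≗⇒⊆ S≗T) T⊆U) nsU) (≗⇒⊆ S≗T)

  pair : V → V → VSet N
  pair a b x = ⌊ x ≟ a ⌋ ∨ ⌊ x ≟ b ⌋

  pair-elim : ∀ {a b x} → pair a b x ≡ true → x ≡ a ⊎ x ≡ b
  pair-elim {a} {b} {x} _ with x ≟ a | x ≟ b
  ... | yes x≡a | _       = inj₁ x≡a
  ... | no _    | yes x≡b = inj₂ x≡b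

  pair-∋ˡ : ∀ a b → pair a b a ≡ true
  pair-∋ˡ a b = cong (_∨ ⌊ a ≟ b ⌋) (⌊⌋-intro (a ≟ a) refl)

  pair-∋ʳ : ∀ a b → pair a b b ≡ true
  pair-∋ʳ a b = trans (cong (⌊ b ≟ a ⌋ ∨_) (⌊⌋-intro (b ≟ b) refl)) (∨-zeroʳ _)

  pair-nonseparable : ∀ {a b} → a ~ b → Nonseparable G (pair a b)
  pair-nonseparable {a} {b} a~b =
    (a , pair-∋ˡ a b) , (λ u v pu pv → reach pu pv pv) ,
    λ z _ u v pu pv → reach (proj₁ (─-elim {S = pair a b} {z} {u} pu)) (proj₁ (─-elim {S = pair a b} {z} {v} pv)) pv
    where
      reach : ∀ {S u v} → pair a b u ≡ true → pair a b v ≡ true → S v ≡ true → Reach G S u v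
      reach {u = u} {v} pu pv Sv with pair-elim {a} {b} {u} pu | pair-elim {a} {b} {v} pv
      ... | inj₁ refl | inj₁ refl = here
      ... | inj₂ refl | inj₂ refl = here
      ... | inj₁ refl | inj₂ refl = step a~b Sv here
      ... | inj₂ refl | inj₁ refl = step (~-sym a~b) Sv here

  -- Cycles

  module Cycle (m : ℕ) (g : Fin (suc (suc (suc m))) → V) (g-injective : Injective _≡_ _≡_ g) where

    open CyclicIndex m g public

    on-cycle : VSet N
    on-cycle x = ⌊ any? (λ j → g j ≟ x) ⌋

    at-on-cycle : ∀ s → on-cycle (at s) ≡ true
    at-on-cycle s = ⌊⌋-intro (any? (λ j → g j ≟ at s)) (s mod K , refl)

    on-cycle-at : ∀ {x} → on-cycle x ≡ true → ∃ λ j → at (toℕ j) ≡ x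
    on-cycle-at {x} e = let j , gj≡x = ⌊⌋-elim (any? (λ j → g j ≟ x)) e in j , trans (at-toℕ j) gj≡x

    module _ (steps : ∀ s → at s ~ at (suc s)) where

      walk : ∀ {S} a t → (∀ i → i ≤ t → S (at (i + a)) ≡ true) → Reach G S (at a) (at (t + a))
      walk a zero    _   = here
      walk a (suc t) inS = reach-snoc (walk a t (λ i i≤t → inS i (m≤n⇒m≤1+n i≤t))) (steps (t + a)) (inS (suc t) ≤-refl)

      walk-around : ∀ c b → c < b → b < K + c → Reach G (on-cycle ─ at c) (at (suc c)) (at b)
      walk-around c b c<b b<K+c = subst (Reach G _ (at (suc c)) ∘ at) (m∸n+n≡m c<b) (walk (suc c) (b ∸ suc c) avoids-c)
        where
          avoids-c : ∀ i → i ≤ b ∸ suc c → (on-cycle ─ at c) (at (i + suc c)) ≡ true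
          avoids-c i i≤ = ─-intro {S = on-cycle} (at-on-cycle (i + suc c))
            (at-window g-injective c (suc i) (s≤s z≤n) (+-cancelʳ-< c (suc i) K 1+i+c<K+c) ∘ subst (λ k → at k ≡ at c) (+-suc i c))
            where
              1+i+c<K+c : suc i + c < K + c
              1+i+c<K+c = ≤-<-trans (≤-trans (≤-reflexive (sym (+-suc i c)))
                                             (subst (i + suc c ≤_) (m∸n+n≡m c<b) (+-monoˡ-≤ (suc c) i≤))) b<K+c

      on-cycle-connected : Connected G on-cycle
      on-cycle-connected = connected-from (at 0) (at-on-cycle 0) λ u e →
        let j , at-j≡u = on-cycle-at e
        in  subst (Reach G on-cycle (at 0)) (trans (cong at (+-identityʳ (toℕ j))) at-j≡u)
                  (walk 0 (toℕ j) (λ i _ → at-on-cycle (i + 0)))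

      on-cycle-─-connected : ∀ c → c < K → Connected G (on-cycle ─ at c)
      on-cycle-─-connected c c<K = connected-from (at (suc c)) next-on-cycle from-next
        where
          next-on-cycle = ─-intro {S = on-cycle} (at-on-cycle (suc c)) (at-window g-injective c 1 (s≤s z≤n) (s≤s (s≤s z≤n)))

          from-next : ∀ u → (on-cycle ─ at c) u ≡ true → Reach G (on-cycle ─ at c) (at (suc c)) u
          from-next u e with ─-elim {S = on-cycle} {at c} {u} e
          ... | e′ , u≢z with on-cycle-at e′
          ... | j , refl with <-cmp c (toℕ j)
          ... | tri< c<a _ _  = walk-around c (toℕ j) c<a (<-≤-trans (toℕ<n j) (m≤m+n K c))
          ... | tri≈ _ c≡a _  = ⊥-elim (u≢z (cong at (sym c≡a)))
          ... | tri> _ _ a<c  = subst (Reach G _ (at (suc c))) (at-periodic (toℕ j))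
                                  (walk-around c (K + toℕ j) (<-≤-trans c<K (m≤m+n K (toℕ j))) (+-monoʳ-< K a<c))

      on-cycle-nonseparable : Nonseparable G on-cycle
      on-cycle-nonseparable = (at 0 , at-on-cycle 0) , on-cycle-connected , λ z e →
        let j , at-j≡z = on-cycle-at e in subst (Connected G ∘ (on-cycle ─_)) at-j≡z (on-cycle-─-connected (toℕ j) (toℕ<n j))

  -- Drawings

  module Drawing {B : VSet N} (D : PODrawing G B) where

    private
      k = proj₁ D
      f : Fin k → V
      f = proj₁ (proj₂ D)
      f-injective = proj₁ (proj₂ (proj₂ D))
      f-onto : ∀ x → B x ≡ true → ∃ λ i → f i ≡ x
      f-onto = proj₁ (proj₂ (proj₂ (proj₂ (proj₂ D))))
      one-crossing = proj₂ (proj₂ (proj₂ (proj₂ (proj₂ D))))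

    rank : V → ℕ
    rank x with any? (λ i → f i ≟ x)
    ... | yes (i , _) = toℕ i
    ... | no _        = 0   -- junk: x is not a vertex of the block

    rank-f : ∀ i → rank (f i) ≡ toℕ i
    rank-f i with any? (λ j → f j ≟ f i)
    ... | yes (j , fj≡fi) = cong toℕ (f-injective fj≡fi)
    ... | no ∄            = ⊥-elim (∄ (i , refl))

    rank-injective : ∀ {x y} → B x ≡ true → B y ≡ true → rank x ≡ rank y → x ≡ y
    rank-injective {x} {y} Bx By eq with f-onto x Bx | f-onto y By
    ... | i , refl | j , refl = cong f (toℕ-injective (trans (sym (rank-f i)) (trans eq (rank-f j))))

    LeftChord : V → V → Set
    LeftChord x y = ∃ λ i → toℕ i < rank x × f i ~ y

    RightChord : V → V → Set
    RightChord x y = ∃ λ j → rank y < toℕ j × x ~ f j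

    left-chord? : ∀ x y → Dec (LeftChord x y)
    left-chord? x y = any? λ i → toℕ i <? rank x ×-dec f i ~? y

    right-chord? : ∀ x y → Dec (RightChord x y)
    right-chord? x y = any? λ j → rank y <? toℕ j ×-dec x ~? f j

    colour< : V → V → Fin 3
    colour< x y with left-chord? x y | right-chord? x y
    ... | no _  | _     = zero
    ... | yes _ | no _  = suc zero
    ... | yes _ | yes _ = suc (suc zero)

    colour<≡0 : ∀ {x y} → colour< x y ≡ zero → ¬ LeftChord x y
    colour<≡0 {x} {y} _ with left-chord? x y | right-chord? x y
    colour<≡0 () | yes _ | no _
    colour<≡0 () | yes _ | yes _
    ... | no ∄ | _ = ∄

    colour<≡1 : ∀ {x y} → colour< x y ≡ suc zero → ¬ RightChord x y
    colour<≡1 {x} {y} _ with left-chord? x y | right-chord? x y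
    colour<≡1 () | no _  | _
    colour<≡1 () | yes _ | yes _
    ... | yes _ | no ∄ = ∄

    colour<≡2 : ∀ {x y} → colour< x y ≡ suc (suc zero) → LeftChord x y × RightChord x y
    colour<≡2 {x} {y} _ with left-chord? x y | right-chord? x y
    colour<≡2 () | no _  | _
    colour<≡2 () | yes _ | no _
    ... | yes left | yes right = left , right

    colour : V → V → Fin 3
    colour x y with <-cmp (rank x) (rank y)
    ... | tri< _ _ _ = colour< x y
    ... | tri≈ _ _ _ = zero
    ... | tri> _ _ _ = colour< y x

    colour-< : ∀ {x y} → rank x < rank y → colour x y ≡ colour< x y
    colour-< {x} {y} x<y with <-cmp (rank x) (rank y)
    ... | tri< _ _ _    = refl
    ... | tri≈ ¬x<y _ _ = ⊥-elim (¬x<y x<y)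
    ... | tri> ¬x<y _ _ = ⊥-elim (¬x<y x<y)

    colour-sym : ∀ x y → colour x y ≡ colour y x
    colour-sym x y with <-cmp (rank x) (rank y) | <-cmp (rank y) (rank x)
    ... | tri< _ _ _    | tri> _ _ _    = refl
    ... | tri≈ _ _ _    | tri≈ _ _ _    = refl
    ... | tri> _ _ _    | tri< _ _ _    = refl
    ... | tri< _ _ ¬y<x | tri< y<x _ _  = ⊥-elim (¬y<x y<x)
    ... | tri< _ x≢y _  | tri≈ _ y≡x _  = ⊥-elim (x≢y (sym y≡x))
    ... | tri≈ ¬x<y _ _ | tri> _ _ x<y  = ⊥-elim (¬x<y x<y)
    ... | tri≈ _ _ ¬y<x | tri< y<x _ _  = ⊥-elim (¬y<x y<x)
    ... | tri> _ x≢y _  | tri≈ _ y≡x _  = ⊥-elim (x≢y (sym y≡x))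
    ... | tri> _ _ y<x  | tri> ¬y<x _ _ = ⊥-elim (¬y<x y<x)

    left-chord : ∀ {x₁ x₂ y} → B x₁ ≡ true → rank x₁ < rank x₂ → x₁ ~ y → LeftChord x₂ y
    left-chord {x₁} Bx₁ x₁<x₂ x₁~y with f-onto x₁ Bx₁
    ... | i , refl = i , subst (_< _) (rank-f i) x₁<x₂ , x₁~y

    right-chord : ∀ {x₁ x₂ y} → B x₂ ≡ true → rank x₁ < rank x₂ → y ~ x₂ → RightChord y x₁
    right-chord {x₂ = x₂} Bx₂ x₁<x₂ y~x₂ with f-onto x₂ Bx₂
    ... | j , refl = j , subst (_ <_) (rank-f j) x₁<x₂ , y~x₂

    chords-cross : ∀ {x₁ x₂ y} → B x₁ ≡ true → B x₂ ≡ true → B y ≡ true → rank x₁ < rank x₂ → rank x₂ < rank y →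
                   LeftChord x₁ y → RightChord x₁ y → RightChord x₂ y → ⊥
    chords-cross {x₁} {x₂} {y} Bx₁ Bx₂ By x₁<x₂ x₂<y (c , c<x₁ , fc~y) (d₁ , y<d₁ , x₁~fd₁) (d₂ , y<d₂ , x₂~fd₂)
      with f-onto x₁ Bx₁ | f-onto x₂ Bx₂ | f-onto y By
    ... | p₁ , refl | p₂ , refl | q , refl =
      <⇒≢ p₁<p₂ (cong toℕ (proj₁ (one-crossing c q p₁ d₁ p₂ d₂ cq p₁d₁ p₂d₂ (inj₁ (c<p₁ , p₁<q , q<d₁)) (inj₁ (c<p₂ , p₂<q , q<d₂)))))
      where
        p₁<p₂ = subst₂ _<_ (rank-f p₁) (rank-f p₂) x₁<x₂
        p₂<q  = subst₂ _<_ (rank-f p₂) (rank-f q) x₂<y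
        p₁<q  = <-trans p₁<p₂ p₂<q
        c<p₁  = subst (_ <_) (rank-f p₁) c<x₁
        c<p₂  = <-trans c<p₁ p₁<p₂
        q<d₁  = subst (_< _) (rank-f q) y<d₁
        q<d₂  = subst (_< _) (rank-f q) y<d₂
        cq : Chord G f c q
        cq = <-trans c<p₁ p₁<q , fc~y
        p₁d₁ : Chord G f p₁ d₁
        p₁d₁ = <-trans p₁<q q<d₁ , x₁~fd₁
        p₂d₂ : Chord G f p₂ d₂
        p₂d₂ = <-trans p₂<q q<d₂ , x₂~fd₂

    sort-by-rank : ∀ (P : V → Set) {x x′} → B x ≡ true → B x′ ≡ true → x ≢ x′ → P x → P x′ →
                   ∃ λ x₁ → ∃ λ x₂ → rank x₁ < rank x₂ × B x₁ ≡ true × B x₂ ≡ true × P x₁ × P x₂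
    sort-by-rank P {x} {x′} Bx Bx′ x≢x′ Px Px′ with <-cmp (rank x) (rank x′)
    ... | tri< x<x′ _ _ = x , x′ , x<x′ , Bx , Bx′ , Px , Px′
    ... | tri≈ _ x≡x′ _ = ⊥-elim (x≢x′ (rank-injective Bx Bx′ x≡x′))
    ... | tri> _ _ x′<x = x′ , x , x′<x , Bx′ , Bx , Px′ , Px

    Below Above : Fin 3 → V → V → Set
    Below c y x = rank x < rank y × x ~ y × colour< x y ≡ c
    Above c y x = rank y < rank x × y ~ x × colour< y x ≡ c

    Wedge : (Fin 3 → V → V → Set) → Fin 3 → Set
    Wedge Side c = ∃ λ y → B y ≡ true ×
      ∃ λ x₁ → ∃ λ x₂ → rank x₁ < rank x₂ × B x₁ ≡ true × B x₂ ≡ true × Side c y x₁ × Side c y x₂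

    no-wedge-below-0 : ¬ Wedge Below zero
    no-wedge-below-0 (_ , _ , _ , _ , x₁<x₂ , Bx₁ , _ , (_ , x₁~y , _) , (_ , _ , col₂)) =
      colour<≡0 col₂ (left-chord Bx₁ x₁<x₂ x₁~y)

    no-wedge-above-1 : ¬ Wedge Above (suc zero)
    no-wedge-above-1 (_ , _ , _ , _ , x₁<x₂ , _ , Bx₂ , (_ , _ , col₁) , (_ , y~x₂ , _)) =
      colour<≡1 col₁ (right-chord Bx₂ x₁<x₂ y~x₂)

    no-wedge-below-2 : ¬ Wedge Below (suc (suc zero))
    no-wedge-below-2 (_ , By , _ , _ , x₁<x₂ , Bx₁ , Bx₂ , (_ , _ , col₁) , (x₂<y , _ , col₂)) =
      chords-cross Bx₁ Bx₂ By x₁<x₂ x₂<y (proj₁ (colour<≡2 col₁)) (proj₂ (colour<≡2 col₁)) (proj₂ (colour<≡2 col₂))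

    module _ (m : ℕ) (g : Fin (suc (suc (suc m))) → V) (g-injective : Injective _≡_ _≡_ g)
             (steps : ∀ s → Cycle.at m g g-injective s ~ Cycle.at m g g-injective (suc s))
             (in-block : ∀ s → B (Cycle.at m g g-injective s) ≡ true) where

      open Cycle m g g-injective

      private
        rank-injective-on-cycle : ∀ s t → rank (at s) ≡ rank (at t) → at s ≡ at t
        rank-injective-on-cycle s t = rank-injective (in-block s) (in-block t)

        two-apart : ∀ s → at s ≢ at (2 + s)
        two-apart s = at-window g-injective s 2 (s≤s z≤n) (s≤s (s≤s (s≤s z≤n))) ∘ sym

        Monochromatic : Fin 3 → Set
        Monochromatic c = ∀ s → colour (at s) (at (suc s)) ≡ c

        peak-wedge : ∀ {c} → Monochromatic c → Wedge Below c
        peak-wedge mono =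
          let s , x<y , x′<y = peak g-injective rank rank-injective-on-cycle in
          at (1 + s) , in-block (1 + s) ,
          sort-by-rank (Below _ (at (1 + s))) (in-block s) (in-block (2 + s)) (two-apart s)
            (x<y , steps s , trans (sym (colour-< x<y)) (mono s))
            (x′<y , ~-sym (steps (1 + s)) , trans (sym (colour-< x′<y)) (trans (colour-sym _ _) (mono (1 + s))))

        valley-wedge : ∀ {c} → Monochromatic c → Wedge Above c
        valley-wedge mono =
          let s , y<x , y<x′ = valley g-injective rank rank-injective-on-cycle in
          at (1 + s) , in-block (1 + s) ,
          sort-by-rank (Above _ (at (1 + s))) (in-block s) (in-block (2 + s)) (two-apart s)
            (y<x , ~-sym (steps s) , trans (sym (colour-< y<x)) (trans (colour-sym _ _) (mono s)))
            (y<x′ , steps (1 + s) , trans (sym (colour-< y<x′)) (mono (1 + s)))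

      no-monochromatic-cycle : ∀ c → ¬ (∀ s → colour (at s) (at (suc s)) ≡ c)
      no-monochromatic-cycle zero             = no-wedge-below-0 ∘ peak-wedge
      no-monochromatic-cycle (suc zero)       = no-wedge-above-1 ∘ valley-wedge
      no-monochromatic-cycle (suc (suc zero)) = no-wedge-below-2 ∘ peak-wedge

  -- Pseudo-outerplanar graphs

  module _ (po : PseudoOuterplanar G) where

    edge-block : ∀ {a b} → a ~ b → ∃ λ B → IsBlock G B × B a ≡ true × B b ≡ true
    edge-block {a} {b} a~b =
      let B , isB , ab⊆B = block-⊇ (pair-nonseparable a~b) in B , isB , ab⊆B a (pair-∋ˡ a b) , ab⊆B b (pair-∋ʳ a b)

    -- Blocks are handled as vectors: the drawing chosen for a block then depends only on its vertices.
    edge-block-code : ∀ {a b} → a ~ b → Subset N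
    edge-block-code a~b = tabulate (proj₁ (edge-block a~b))

    edge-block-code≡ : ∀ {a b B} (a~b : a ~ b) → IsBlock G B → B a ≡ true → B b ≡ true → edge-block-code a~b ≡ tabulate B
    edge-block-code≡ a~b isB Ba Bb =
      let _ , isB′ , B′a , B′b = edge-block a~b in tabulate-cong (blocks-≗ isB′ isB (~-irrefl a~b) B′a B′b Ba Bb)

    block-colour : Subset N → V → V → Fin 3
    block-colour p with block? (lookup p)
    ... | yes isB = Drawing.colour (po (lookup p) isB)
    ... | no _    = λ _ _ → zero

    block-colour-sym : ∀ p u v → block-colour p u v ≡ block-colour p v u
    block-colour-sym p u v with block? (lookup p)
    ... | yes isB = Drawing.colour-sym (po (lookup p) isB) u v
    ... | no _    = refl

    block-colour-drawing : ∀ p → IsBlock G (lookup p) →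
                           ∃ λ (D : PODrawing G (lookup p)) → ∀ u v → block-colour p u v ≡ Drawing.colour D u v
    block-colour-drawing p isB with block? (lookup p)
    ... | yes isB′ = po (lookup p) isB′ , λ _ _ → refl
    ... | no ¬isB  = ⊥-elim (¬isB isB)

    edge-colour : V → V → Fin 3
    edge-colour u v with u ~? v
    ... | yes u~v = block-colour (edge-block-code u~v) u v
    ... | no _    = zero

    edge-colour-sym : ∀ u v → edge-colour u v ≡ edge-colour v u
    edge-colour-sym u v with u ~? v | v ~? u
    ... | yes u~v | yes v~u = let _ , isB , Bu , Bv = edge-block u~v in
      trans (block-colour-sym _ u v) (cong (λ p → block-colour p v u) (sym (edge-block-code≡ v~u isB Bv Bu)))
    ... | no _    | no _    = refl
    ... | yes u~v | no ¬v~u = ⊥-elim (¬v~u (~-sym u~v))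
    ... | no ¬u~v | yes v~u = ⊥-elim (¬u~v (~-sym v~u))

    edge-colour-in-block : ∀ {B u v} → IsBlock G B → u ~ v → B u ≡ true → B v ≡ true →
                           edge-colour u v ≡ block-colour (tabulate B) u v
    edge-colour-in-block {u = u} {v} isB u~v Bu Bv with u ~? v
    ... | yes u~v′ = cong (λ p → block-colour p u v) (edge-block-code≡ u~v′ isB Bu Bv)
    ... | no ¬u~v  = ⊥-elim (¬u~v u~v)

    edge-colour-acyclic : ∀ c → ¬ MonoCycle G edge-colour c
    edge-colour-acyclic c (m , g , g-injective , path , close) =
      Drawing.no-monochromatic-cycle D m g g-injective steps (≗⇒⊆ B≗p _ ∘ in-B) c monochromatic
      where
        open Cycle m g g-injective

        coloured : ∀ s → at s ~ at (suc s) × edge-colour (at s) (at (suc s)) ≡ c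
        coloured = at-step (λ x y → x ~ y × edge-colour x y ≡ c) path close

        steps = proj₁ ∘ coloured
        B-data = edge-block (steps 0)
        B = proj₁ B-data
        isB = proj₁ (proj₂ B-data)
        B≗p = sym ∘ lookup∘tabulate B

        in-B : ∀ s → B (at s) ≡ true
        in-B s = nonseparable⊆block isB (on-cycle-nonseparable steps) (~-irrefl (steps 0))
                   (proj₁ (proj₂ (proj₂ B-data))) (proj₂ (proj₂ (proj₂ B-data))) (at-on-cycle 0) (at-on-cycle 1)
                   (at s) (at-on-cycle s)

        D = proj₁ (block-colour-drawing (tabulate B) (block-≗ B≗p isB))

        monochromatic : ∀ s → Drawing.colour D (at s) (at (suc s)) ≡ c
        monochromatic s = begin
          Drawing.colour D (at s) (at (suc s))          ≡⟨ proj₂ (block-colour-drawing (tabulate B) (block-≗ B≗p isB)) _ _ ⟨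
          block-colour (tabulate B) (at s) (at (suc s)) ≡⟨ edge-colour-in-block isB (steps s) (in-B s) (in-B (suc s)) ⟨
          edge-colour (at s) (at (suc s))               ≡⟨ proj₂ (coloured s) ⟩
          c                                             ∎
          where open ≡-Reasoning

    arboricity≤3 : ArboricityAtMost G 3
    arboricity≤3 = edge-colour , edge-colour-sym , edge-colour-acyclic

-- Two copies of K₄ sharing an edge

H-edges : Vec (Fin 6 × Fin 6) 11
H-edges = (# 0 , # 1) ∷ (# 1 , # 2) ∷ (# 2 , # 3) ∷ (# 3 , # 4) ∷ (# 4 , # 5) ∷ (# 0 , # 5)
        ∷ (# 0 , # 2) ∷ (# 1 , # 3) ∷ (# 0 , # 3) ∷ (# 0 , # 4) ∷ (# 3 , # 5) ∷ []

Joins : Fin 11 → Fin 6 → Fin 6 → Set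
Joins e x y = lookup H-edges e ≡ (x , y) ⊎ lookup H-edges e ≡ (y , x)

joins? : ∀ e x y → Dec (Joins e x y)
joins? e x y = ≡-dec _≟_ _≟_ (lookup H-edges e) (x , y) ⊎-dec ≡-dec _≟_ _≟_ (lookup H-edges e) (y , x)

H-adj : Fin 6 → Fin 6 → Bool
H-adj x y = ⌊ any? (λ e → joins? e x y) ⌋

H : Graph
H = record
  { n       = 6
  ; adj     = H-adj
  ; adj-sym = from-yes (all? λ x → all? λ y → H-adj x y ≟ᵇ H-adj y x)
  ; adj-irr = from-yes (all? λ x → H-adj x x ≟ᵇ false)
  }

module Hexagon = Cycle H 3 id id

hexagon-steps : ∀ s → adj H (Hexagon.at s) (Hexagon.at (1 + s)) ≡ true
hexagon-steps = Hexagon.at-step (_~_ H) (from-yes (all? λ j → H-adj (inject₁ j) (suc j) ≟ᵇ true)) refl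

H-nonseparable : Nonseparable H (λ _ → true)
H-nonseparable = nonseparable-≗ H (from-yes (all? λ x → Hexagon.on-cycle x ≟ᵇ true)) (Hexagon.on-cycle-nonseparable hexagon-steps)

H-block-full : ∀ {B} → IsBlock H B → ∀ x → B x ≡ true
H-block-full (_ , maximal) x = maximal (λ _ → true) (λ _ _ → refl) H-nonseparable x refl

-- The chord crossing a b when H is drawn in vertex order (junk when a b crosses nothing).
partner : Fin 6 → Fin 6 → Fin 6 × Fin 6
partner a b with toℕ a | toℕ b
... | 0 | 2 = # 1 , # 3
... | 1 | 3 = # 0 , # 2
... | 0 | 4 = # 3 , # 5
... | 3 | 5 = # 0 , # 4
... | _ | _ = a , b

crossing-partner : ∀ a b c d → Chord H id a b → Chord H id c d → Cross H a b c d → (c , d) ≡ partner a b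
crossing-partner = from-yes (all? λ a → all? λ b → all? λ c → all? λ d →
  chord? a b →-dec chord? c d →-dec cross? a b c d →-dec ≡-dec _≟_ _≟_ (c , d) (partner a b))
  where
    chord? : ∀ a b → Dec (Chord H id a b)
    chord? a b = a Fin.<? b ×-dec H-adj a b ≟ᵇ true
    cross? : ∀ a b c d → Dec (Cross H a b c d)
    cross? a b c d = (a Fin.<? c ×-dec c Fin.<? b ×-dec b Fin.<? d) ⊎-dec (c Fin.<? a ×-dec a Fin.<? d ×-dec d Fin.<? b)

H-pseudo-outerplanar : PseudoOuterplanar H
H-pseudo-outerplanar B isB = 6 , id , id , H-block-full isB , (λ x _ → x , refl) ,
  λ a b c d c′ d′ ab cd c′d′ cross cross′ →
    let same = trans (crossing-partner a b c d ab cd cross) (sym (crossing-partner a b c′ d′ ab c′d′ cross′))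
    in cong proj₁ same , cong proj₂ same

Candidate : Set
Candidate = ∃ λ m → Vec (Fin 6) (3 + m)

IsCycle : Candidate → Set
IsCycle (m , v) = (∀ i j → lookup v i ≡ lookup v j → i ≡ j)
                × (∀ j → H-adj (lookup v (inject₁ j)) (lookup v (suc j)) ≡ true)
                × H-adj (lookup v (fromℕ _)) (lookup v zero) ≡ true

Monochromatic : (Fin 6 → Fin 6 → Bool) → Candidate → Set
Monochromatic κ (m , v) = (∀ j → κ (lookup v (inject₁ j)) (lookup v (suc j)) ≡ κ₀₁)
                        × κ (lookup v (fromℕ _)) (lookup v zero) ≡ κ₀₁
  where κ₀₁ = κ (lookup v zero) (lookup v (suc zero))

candidates : List Candidate
candidates =
    (0 , # 0 ∷ # 4 ∷ # 3 ∷ [])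
  ∷ (0 , # 3 ∷ # 5 ∷ # 4 ∷ [])
  ∷ (0 , # 0 ∷ # 5 ∷ # 3 ∷ [])
  ∷ (0 , # 0 ∷ # 4 ∷ # 5 ∷ [])
  ∷ (0 , # 0 ∷ # 1 ∷ # 3 ∷ [])
  ∷ (0 , # 1 ∷ # 3 ∷ # 2 ∷ [])
  ∷ (0 , # 0 ∷ # 2 ∷ # 1 ∷ [])
  ∷ (0 , # 0 ∷ # 2 ∷ # 3 ∷ [])
  ∷ (1 , # 0 ∷ # 1 ∷ # 3 ∷ # 5 ∷ [])
  ∷ (1 , # 0 ∷ # 3 ∷ # 1 ∷ # 2 ∷ [])
  ∷ (1 , # 0 ∷ # 1 ∷ # 2 ∷ # 3 ∷ [])
  ∷ (1 , # 0 ∷ # 2 ∷ # 3 ∷ # 4 ∷ [])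
  ∷ (1 , # 0 ∷ # 5 ∷ # 4 ∷ # 3 ∷ [])
  ∷ (1 , # 0 ∷ # 4 ∷ # 5 ∷ # 3 ∷ [])
  ∷ (1 , # 0 ∷ # 1 ∷ # 3 ∷ # 4 ∷ [])
  ∷ (1 , # 0 ∷ # 5 ∷ # 3 ∷ # 2 ∷ [])
  ∷ (2 , # 0 ∷ # 4 ∷ # 5 ∷ # 3 ∷ # 1 ∷ [])
  ∷ (2 , # 0 ∷ # 2 ∷ # 3 ∷ # 4 ∷ # 5 ∷ [])
  ∷ (2 , # 0 ∷ # 1 ∷ # 2 ∷ # 3 ∷ # 4 ∷ [])
  ∷ (2 , # 0 ∷ # 2 ∷ # 1 ∷ # 3 ∷ # 4 ∷ [])
  ∷ (2 , # 0 ∷ # 2 ∷ # 3 ∷ # 5 ∷ # 4 ∷ [])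
  ∷ (2 , # 0 ∷ # 5 ∷ # 3 ∷ # 1 ∷ # 2 ∷ [])
  ∷ (2 , # 0 ∷ # 5 ∷ # 4 ∷ # 3 ∷ # 1 ∷ [])
  ∷ (2 , # 0 ∷ # 5 ∷ # 3 ∷ # 2 ∷ # 1 ∷ [])
  ∷ (3 , # 0 ∷ # 2 ∷ # 1 ∷ # 3 ∷ # 5 ∷ # 4 ∷ [])
  ∷ (3 , # 0 ∷ # 2 ∷ # 1 ∷ # 3 ∷ # 4 ∷ # 5 ∷ [])
  ∷ (3 , # 0 ∷ # 1 ∷ # 2 ∷ # 3 ∷ # 5 ∷ # 4 ∷ [])
  ∷ (3 , # 0 ∷ # 1 ∷ # 2 ∷ # 3 ∷ # 4 ∷ # 5 ∷ [])
  ∷ []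

candidates-are-cycles : All IsCycle candidates
candidates-are-cycles = from-yes (All.all? cycle? candidates)
  where
    cycle? : ∀ c → Dec (IsCycle c)
    cycle? (m , v) = (all? λ i → all? λ j → lookup v i ≟ lookup v j →-dec i ≟ j)
                   ×-dec (all? λ j → H-adj (lookup v (inject₁ j)) (lookup v (suc j)) ≟ᵇ true)
                   ×-dec H-adj (lookup v (fromℕ _)) (lookup v zero) ≟ᵇ true

-- Entry x y is the position of xy in H-edges (junk 0 when x and y are not adjacent).
edge-index : Fin 6 → Fin 6 → Fin 11
edge-index x y = lookup (lookup table x) y
  where
    table : Vec (Vec (Fin 11) 6) 6
    table = (# 0 ∷ # 0 ∷ # 6 ∷ # 8 ∷ # 9 ∷ # 5  ∷ [])
          ∷ (# 0 ∷ # 0 ∷ # 1 ∷ # 7 ∷ # 0 ∷ # 0  ∷ [])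
          ∷ (# 6 ∷ # 1 ∷ # 0 ∷ # 2 ∷ # 0 ∷ # 0  ∷ [])
          ∷ (# 8 ∷ # 7 ∷ # 2 ∷ # 0 ∷ # 3 ∷ # 10 ∷ [])
          ∷ (# 9 ∷ # 0 ∷ # 0 ∷ # 3 ∷ # 0 ∷ # 4  ∷ [])
          ∷ (# 5 ∷ # 0 ∷ # 0 ∷ # 10 ∷ # 4 ∷ # 0 ∷ [])
          ∷ []

edge-index-joins : ∀ x y → H-adj x y ≡ true → Joins (edge-index x y) x y
edge-index-joins = from-yes (all? λ x → all? λ y → H-adj x y ≟ᵇ true →-dec joins? (edge-index x y) x y)

-- An edge 2-colouring of H is encoded as a subset of the positions in H-edges.
some-candidate-monochromatic : ∀ (w : Subset 11) → Any (Monochromatic (λ x y → lookup w (edge-index x y))) candidates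
some-candidate-monochromatic w = decidable-stable (Any.any? (mono? w) candidates)
  λ none → from-no (anySubset? (λ w → ¬? (Any.any? (mono? w) candidates))) (w , none)
  where
    mono? : ∀ w c → Dec (Monochromatic (λ x y → lookup w (edge-index x y)) c)
    mono? w (m , v) = (all? λ j → κ (lookup v (inject₁ j)) (lookup v (suc j)) ≟ᵇ κ₀₁) ×-dec κ (lookup v (fromℕ _)) (lookup v zero) ≟ᵇ κ₀₁
      where
        κ = λ x y → lookup w (edge-index x y)
        κ₀₁ = κ (lookup v zero) (lookup v (suc zero))

is-zero : Fin 2 → Bool
is-zero c = ⌊ c ≟ zero ⌋

is-zero-injective : ∀ a b → is-zero a ≡ is-zero b → a ≡ b
is-zero-injective zero       zero       _  = refl
is-zero-injective (suc zero) (suc zero) _  = refl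
is-zero-injective zero       (suc zero) ()
is-zero-injective (suc zero) zero       ()

H-not-2-forests : ¬ ForestPartition H 2
H-not-2-forests (col , col-sym , acyclic) =
  no-monochromatic-candidate (some-candidate-monochromatic (tabulate bit))
  where
    bit : Fin 11 → Bool
    bit e = is-zero (col (proj₁ (lookup H-edges e)) (proj₂ (lookup H-edges e)))

    κ : Fin 6 → Fin 6 → Bool
    κ x y = lookup (tabulate bit) (edge-index x y)

    joined-bit : ∀ e {x y} → Joins e x y → bit e ≡ is-zero (col x y)
    joined-bit _ (inj₁ e≡xy) = cong (λ p → is-zero (col (proj₁ p) (proj₂ p))) e≡xy
    joined-bit _ {y = y} (inj₂ e≡yx) = trans (cong (λ p → is-zero (col (proj₁ p) (proj₂ p))) e≡yx) (cong is-zero (col-sym y _))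

    κ≡ : ∀ {x y} → H-adj x y ≡ true → κ x y ≡ is-zero (col x y)
    κ≡ {x} {y} x~y = trans (lookup∘tabulate bit (edge-index x y)) (joined-bit (edge-index x y) (edge-index-joins x y x~y))

    same-colour : ∀ {x y x′ y′} → H-adj x y ≡ true → H-adj x′ y′ ≡ true → κ x y ≡ κ x′ y′ → col x y ≡ col x′ y′
    same-colour x~y x′~y′ eq = is-zero-injective _ _ (trans (sym (κ≡ x~y)) (trans eq (κ≡ x′~y′)))

    monochromatic-cycle : ∀ c → IsCycle c × Monochromatic κ c → ∃ λ i → MonoCycle H col i
    monochromatic-cycle (m , v) ((injective , path , close) , (mono , mono-close)) =
      col (lookup v zero) (lookup v (suc zero)) , m , lookup v , (λ {i} {j} → injective i j) ,
      (λ j → path j , same-colour (path j) (path zero) (mono j)) , close , same-colour close (path zero) mono-close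

    no-monochromatic-candidate : Any (Monochromatic κ) candidates → ⊥
    no-monochromatic-candidate mono =
      let i , cycle = monochromatic-cycle (Any.lookup mono) (lookupAny candidates-are-cycles mono) in acyclic i cycle

corollary3p9 : ((G : Graph) → PseudoOuterplanar G → ArboricityAtMost G 3)
    × Σ Graph (λ G → PseudoOuterplanar G × ArboricityExactly G 3)
corollary3p9 = arboricity≤3 , H , H-pseudo-outerplanar , arboricity≤3 H H-pseudo-outerplanar , H-not-2-forests
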